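{- Let $T$ be a tree of order $n\geq 3$. If $\operatorname{diam}(T)\leq 3$, then $\chi_d^t(T)=s+1$, where $s$ is the number of support vertices of $T$.
   Context: $\operatorname{diam}(T)$ is the maximum distance between two vertices. In a tree, a leaf is a vertex of degree one, and a support vertex is a neighbor of a leaf that has degree more than one. A total dominator coloring of a graph $G$ is a proper vertex coloring of $G$ in which each vertex of $G$ is adjacent to every vertex of some color class; $\chi_d^t(G)$ is the minimum number of color classes in a total dominator coloring of $G$. -}

module Defs where

open import Data.Nat using (ℕ; zero; suc; _≤_; _<_; _+_)
open import Data.Fin using (Fin; inject₁; fromℕ)
open import Data.Fin.Properties using (any?)
open import Data.List using (List; length; filter; allFin)
open import Data.Product using (Σ; ∃; ∃-syntax; _×_; _,_)
open import Relation.Nullary using (¬_; Dec; yes; no)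
open import Relation.Nullary.Decidable using (_×-dec_)
open import Relation.Binary.PropositionalEquality using (_≡_; _≢_)
open import Function using (Injective; Surjective)

record Graph (n : ℕ) : Set₁ where
  field
    Adj     : Fin n → Fin n → Set
    adj?    : ∀ u v → Dec (Adj u v)
    symm    : ∀ {u v} → Adj u v → Adj v u
    irrefl  : ∀ {u} → ¬ Adj u u

module _ {n : ℕ} (G : Graph n) where
  open Graph G

  data Walk : Fin n → Fin n → ℕ → Set where
    here : ∀ {u} → Walk u u 0
    step : ∀ {u w v k} → Adj u w → Walk w v k → Walk u v (suc k)

  Connected : Set
  Connected = ∀ u v → ∃[ k ] Walk u v k

  -- a cycle of length m+3: distinct vertices f 0, …, f (m+2),
  -- consecutive ones adjacent, and the last adjacent to the first
  record Cycle (m : ℕ) : Set where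
    field
      vert   : Fin (suc (suc (suc m))) → Fin n
      inj    : Injective _≡_ _≡_ vert
      edges  : ∀ (i : Fin (suc (suc m))) → Adj (vert (inject₁ i)) (vert (Fin.suc i))
      close  : Adj (vert (fromℕ (suc (suc m)))) (vert Fin.zero)

  Acyclic : Set
  Acyclic = ∀ m → ¬ Cycle m

  IsTree : Set
  IsTree = Connected × Acyclic

  DiamAtMost : ℕ → Set
  DiamAtMost d = ∀ u v → ∃[ k ] (k ≤ d × Walk u v k)

  deg : Fin n → ℕ
  deg v = length (filter (adj? v) (allFin n))

  IsLeaf : Fin n → Set
  IsLeaf v = deg v ≡ 1

  isLeaf? : ∀ v → Dec (IsLeaf v)
  isLeaf? v = deg v Data.Nat.≟ 1

  IsSupport : Fin n → Set
  IsSupport v = (∃[ w ] (Adj v w × IsLeaf w)) × (1 < deg v)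

  isSupport? : ∀ v → Dec (IsSupport v)
  isSupport? v = any? (λ w → adj? v w ×-dec isLeaf? w) ×-dec (2 Data.Nat.≤? deg v)

  numSupport : ℕ
  numSupport = length (filter isSupport? (allFin n))

  -- a total dominator coloring with exactly k (nonempty) color classes:
  -- a surjective proper coloring c : V → Fin k such that every vertex is
  -- adjacent to every vertex of some color class
  record TotalDominatorColoring (k : ℕ) : Set where
    field
      color     : Fin n → Fin k
      onto      : Surjective _≡_ _≡_ color
      proper    : ∀ {u v} → Adj u v → color u ≢ color v
      dominates : ∀ v → ∃[ j ] (∀ u → color u ≡ j → Adj v u)

  TotalDominatorChromaticNumber : ℕ → Set
  TotalDominatorChromaticNumber m =
    TotalDominatorColoring m × (∀ k → TotalDominatorColoring k → m ≤ k)

module Submission where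

-- Lower bound (valid in every graph with a non-support vertex): in a total dominator
-- colouring, the leaf hanging at a support vertex v must dominate a whole colour class,
-- and its only neighbour is v, so {v} is a colour class.  Hence the s support vertices
-- and any non-support vertex receive s + 1 pairwise different colours.
--
-- Upper bound: give every support vertex its own colour and all other vertices one
-- common colour.  This works because in a tree of diameter ≤ 3 every vertex is a leaf or
-- a support vertex, no two leaves are adjacent, and a support vertex with no support
-- neighbour is adjacent to every leaf.  These structural facts come from non-backtracking
-- walks: in an acyclic graph there is no closed one, so all non-backtracking walks between
-- two vertices have the same length; as some walk of length ≤ 3 exists, none is longer
-- than 3, i.e. there is no path x₀x₁x₂x₃x₄.

open import Defs
open import Data.Nat using (ℕ; zero; suc; _≤_; _<_; _+_; _∸_; z≤n; s≤s; z<s; _<?_)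
open import Data.Nat.Properties
  using (≤-refl; ≤-trans; ≤-<-trans; <⇒≤; <-cmp; +-identityʳ; +-suc; m+[n∸m]≡n; m∸n≤m;
         m<n⇒0<n∸m; m<n⇒m<1+n; n≤1+n; ∸-monoʳ-<; n∸n≡0; <-irrefl)
open import Data.Fin using (Fin; toℕ; inject₁; fromℕ; fromℕ<; _≟_)
open import Data.Fin.Properties using (any?; 0≢1+n; suc-injective; toℕ-inject₁; toℕ-fromℕ; toℕ<n; toℕ-injective; injective⇒≤)
open import Data.Product using (Σ; ∃; ∃₂; _×_; _,_; proj₁; proj₂)
open import Data.Sum using (_⊎_; inj₁; inj₂)
open import Data.Empty using (⊥; ⊥-elim)
open import Data.List using (List; []; _∷_; length; filter; allFin; lookup)
open import Data.List.Membership.Propositional using (_∈_)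
open import Data.List.Membership.Propositional.Properties using (∈-filter⁺; ∈-filter⁻; ∈-allFin; ∈-lookup)
open import Data.List.Relation.Unary.Any using (here; there; index)
open import Data.List.Relation.Unary.Any.Properties using (lookup-index)
import Data.List.Relation.Unary.All as All
open import Data.List.Relation.Unary.Unique.Propositional using (Unique)
open import Data.List.Relation.Unary.AllPairs using (_∷_)
open import Data.List.Relation.Unary.Unique.Propositional.Properties using (allFin⁺; filter⁺)
open import Function using (Injective; Surjective; _∘_)
open import Induction.WellFounded using (Acc; acc)
open import Data.Nat.Induction using (<-wellFounded)
open import Relation.Binary using (tri<; tri≈; tri>; DecidableEquality)
open import Relation.Binary.PropositionalEquality using (_≡_; _≢_; refl; sym; trans; cong; subst)
open import Relation.Nullary using (¬_; yes; no)
open import Relation.Nullary.Decidable using (_×-dec_)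
open import Relation.Unary using (Decidable)

length≡1⇒∃∈ : ∀ {A : Set} {xs : List A} → length xs ≡ 1 → ∃ λ x → x ∈ xs
length≡1⇒∃∈ {xs = x ∷ _} _ = x , here refl

length≡1⇒∈-unique : ∀ {A : Set} {xs : List A} {a b : A} → length xs ≡ 1 → a ∈ xs → b ∈ xs → a ≡ b
length≡1⇒∈-unique {xs = _ ∷ []} _ (here a≡x) (here b≡x) = trans a≡x (sym b≡x)
length≡1⇒∈-unique {xs = _ ∷ []} _ (here _) (there ())
length≡1⇒∈-unique {xs = _ ∷ []} _ (there ()) _

∈⇒length≢0 : ∀ {A : Set} {xs : List A} {a : A} → a ∈ xs → length xs ≢ 0
∈⇒length≢0 (here _) ()
∈⇒length≢0 (there _) ()

unique⇒two-distinct : ∀ {A : Set} {xs : List A} → Unique xs → 2 ≤ length xs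
                    → ∃₂ λ a b → a ∈ xs × b ∈ xs × a ≢ b
unique⇒two-distinct {xs = x ∷ y ∷ _} (x∉ ∷ _) _ = x , y , here refl , there (here refl) , All.head x∉
unique⇒two-distinct {xs = _ ∷ []} _ (s≤s ())

lookup-injective : ∀ {A : Set} {xs : List A} → Unique xs → Injective _≡_ _≡_ (lookup xs)
lookup-injective {xs = _ ∷ _} _ {Fin.zero} {Fin.zero} _ = refl
lookup-injective {xs = _ ∷ _} (x∉ ∷ _) {Fin.zero} {Fin.suc j} e = ⊥-elim (All.lookup x∉ (∈-lookup j) e)
lookup-injective {xs = _ ∷ _} (x∉ ∷ _) {Fin.suc i} {Fin.zero} e = ⊥-elim (All.lookup x∉ (∈-lookup i) (sym e))
lookup-injective {xs = _ ∷ _} (_ ∷ u) {Fin.suc i} {Fin.suc j} e = cong Fin.suc (lookup-injective u e)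

third-element : ∀ {m} → 3 ≤ m → (u w : Fin m) → ∃ λ z → z ≢ u × z ≢ w
third-element (s≤s (s≤s (s≤s _))) Fin.zero Fin.zero = Fin.suc Fin.zero , (λ ()) , (λ ())
third-element (s≤s (s≤s (s≤s _))) Fin.zero (Fin.suc Fin.zero) = Fin.suc (Fin.suc Fin.zero) , (λ ()) , (λ ())
third-element (s≤s (s≤s (s≤s _))) Fin.zero (Fin.suc (Fin.suc _)) = Fin.suc Fin.zero , (λ ()) , (λ ())
third-element (s≤s (s≤s (s≤s _))) (Fin.suc Fin.zero) Fin.zero = Fin.suc (Fin.suc Fin.zero) , (λ ()) , (λ ())
third-element (s≤s (s≤s (s≤s _))) (Fin.suc Fin.zero) (Fin.suc _) = Fin.zero , (λ ()) , (λ ())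
third-element (s≤s (s≤s (s≤s _))) (Fin.suc (Fin.suc _)) Fin.zero = Fin.suc Fin.zero , (λ ()) , (λ ())
third-element (s≤s (s≤s (s≤s _))) (Fin.suc (Fin.suc _)) (Fin.suc _) = Fin.zero , (λ ()) , (λ ())

injective-or-repeat : ∀ {m} {A : Set} → DecidableEquality A → (f : Fin m → A)
                    → Injective _≡_ _≡_ f ⊎ ∃₂ λ i j → toℕ i < toℕ j × f i ≡ f j
injective-or-repeat _≟A_ f with any? (λ i → any? (λ j → (toℕ i <? toℕ j) ×-dec (f i ≟A f j)))
... | yes repeat = inj₂ repeat
... | no no-repeat = inj₁ injective
  where
    injective : Injective _≡_ _≡_ f
    injective {a} {b} fa≡fb with <-cmp (toℕ a) (toℕ b)
    ... | tri< a<b _ _ = ⊥-elim (no-repeat (a , b , a<b , fa≡fb))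
    ... | tri≈ _ a≡b _ = toℕ-injective a≡b
    ... | tri> _ _ b<a = ⊥-elim (no-repeat (b , a , b<a , sym fa≡fb))

module Enumeration {n : ℕ} {P : Fin n → Set} (P? : Decidable P) where

  members : List (Fin n)
  members = filter P? (allFin n)

  size : ℕ
  size = length members

  element : Fin size → Fin n
  element = lookup members

  element-satisfies : ∀ i → P (element i)
  element-satisfies i = proj₂ (∈-filter⁻ P? {xs = allFin n} (∈-lookup i))

  element-injective : Injective _≡_ _≡_ element
  element-injective = lookup-injective (filter⁺ P? (allFin⁺ n))

  position : ∀ {v} → P v → Fin size
  position {v} pv = index (∈-filter⁺ P? (∈-allFin v) pv)

  element-position : ∀ {v} (pv : P v) → element (position pv) ≡ v
  element-position {v} pv = sym (lookup-index (∈-filter⁺ P? (∈-allFin v) pv))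

module Neighbourhood {n : ℕ} (G : Graph n) where
  open Graph G

  N : Fin n → List (Fin n)
  N v = filter (adj? v) (allFin n)

  Adj⇒∈N : ∀ {v a} → Adj v a → a ∈ N v
  Adj⇒∈N {v} {a} va = ∈-filter⁺ (adj? v) (∈-allFin a) va

  ∈N⇒Adj : ∀ {v a} → a ∈ N v → Adj v a
  ∈N⇒Adj {v} a∈N = proj₂ (∈-filter⁻ (adj? v) {xs = allFin n} a∈N)

  leaf-neighbour : ∀ {v} → IsLeaf G v → ∃ λ c → Adj v c
  leaf-neighbour leaf with length≡1⇒∃∈ leaf
  ... | c , c∈N = c , ∈N⇒Adj c∈N

  leaf-neighbour-unique : ∀ {v a b} → IsLeaf G v → Adj v a → Adj v b → a ≡ b
  leaf-neighbour-unique leaf va vb = length≡1⇒∈-unique leaf (Adj⇒∈N va) (Adj⇒∈N vb)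

  leaf⇒¬support : ∀ {v} → IsLeaf G v → ¬ IsSupport G v
  leaf⇒¬support leaf (_ , 1<deg) = <-irrefl (sym leaf) 1<deg

  adjacent-non-leaf⇒2≤deg : ∀ {x y} → Adj x y → ¬ IsLeaf G x → 2 ≤ deg G x
  adjacent-non-leaf⇒2≤deg {x} xy ¬leaf with deg G x | ∈⇒length≢0 (Adj⇒∈N xy)
  ... | zero | deg≢0 = ⊥-elim (deg≢0 refl)
  ... | suc zero | _ = ⊥-elim (¬leaf refl)
  ... | suc (suc _) | _ = s≤s (s≤s z≤n)

  neighbour-avoiding : ∀ {v} → 2 ≤ deg G v → ∀ y → ∃ λ a → Adj v a × a ≢ y
  neighbour-avoiding {v} 2≤deg y with unique⇒two-distinct (filter⁺ (adj? v) (allFin⁺ n)) 2≤deg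
  ... | a , b , a∈N , b∈N , a≢b with a ≟ y
  ... | no a≢y = a , ∈N⇒Adj a∈N , a≢y
  ... | yes a≡y = b , ∈N⇒Adj b∈N , λ b≡y → a≢b (trans a≡y (sym b≡y))

module NonBacktracking {n : ℕ} (G : Graph n) where
  open Graph G
  open Neighbourhood G

  record NBWalk (u v : Fin n) (L : ℕ) : Set where
    field
      vertex : ℕ → Fin n
      start  : vertex 0 ≡ u
      end    : vertex L ≡ v
      adj    : ∀ i → i < L → Adj (vertex i) (vertex (suc i))
      nb     : ∀ i → suc (suc i) ≤ L → vertex i ≢ vertex (suc (suc i))
  open NBWalk public

  trivial : ∀ {u} → NBWalk u u 0
  trivial {u} = record { vertex = λ _ → u ; start = refl ; end = refl ; adj = λ _ () ; nb = λ _ () }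

  restart : ∀ {u u′ v L} → u ≡ u′ → NBWalk u v L → NBWalk u′ v L
  restart e P = record { vertex = vertex P ; start = trans (start P) e ; end = end P ; adj = adj P ; nb = nb P }

  retarget : ∀ {u v v′ L} → NBWalk u v L → v ≡ v′ → NBWalk u v′ L
  retarget P e = record { vertex = vertex P ; start = start P ; end = trans (end P) e ; adj = adj P ; nb = nb P }

  first-edge : ∀ {u v L} (P : NBWalk u v (suc L)) → Adj u (vertex P 1)
  first-edge P = subst (λ x → Adj x (vertex P 1)) (start P) (adj P 0 z<s)

  -- Interior vertices of a non-backtracking walk have two different neighbours on it,
  -- so they are not leaves.
  interior-not-leaf : ∀ {u v L} (P : NBWalk u v L) i → suc (suc i) ≤ L → ¬ IsLeaf G (vertex P (suc i))
  interior-not-leaf P i h leaf =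
    nb P i h (leaf-neighbour-unique leaf (symm (adj P i (<⇒≤ h))) (adj P (suc i) h))

  cons : ∀ {u w v L} → Adj u w → (Q : NBWalk w v L) → (1 ≤ L → u ≢ vertex Q 1) → NBWalk u v (suc L)
  cons {u} {L = L} uw Q no-return = record
    { vertex = vertex′ ; start = refl ; end = end Q ; adj = adj′ ; nb = nb′ }
    where
      vertex′ : ℕ → Fin n
      vertex′ zero = u
      vertex′ (suc i) = vertex Q i
      adj′ : ∀ i → i < suc L → Adj (vertex′ i) (vertex′ (suc i))
      adj′ zero _ = subst (Adj u) (sym (start Q)) uw
      adj′ (suc i) (s≤s i<L) = adj Q i i<L
      nb′ : ∀ i → suc (suc i) ≤ suc L → vertex′ i ≢ vertex′ (suc (suc i))
      nb′ zero (s≤s 1≤L) = no-return 1≤L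
      nb′ (suc i) (s≤s h) = nb Q i h

  take : ∀ {u v L} (P : NBWalk u v L) j → j ≤ L → NBWalk u (vertex P j) j
  take P j j≤L = record
    { vertex = vertex P ; start = start P ; end = refl
    ; adj = λ i i<j → adj P i (≤-trans i<j j≤L) ; nb = λ i h → nb P i (≤-trans h j≤L) }

  drop : ∀ {u v L} (P : NBWalk u v L) i → i ≤ L → NBWalk (vertex P i) v (L ∸ i)
  drop {L = L} P i i≤L = record
    { vertex = λ k → vertex P (i + k)
    ; start = cong (vertex P) (+-identityʳ i)
    ; end = trans (cong (vertex P) (m+[n∸m]≡n i≤L)) (end P)
    ; adj = adj′ ; nb = nb′ }
    where
      offset-< : ∀ i {k L} → k < L ∸ i → i + k < L
      offset-< zero k<L = k<L
      offset-< (suc i) {L = suc L} k<L∸i = s≤s (offset-< i k<L∸i)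
      adj′ : ∀ k → k < L ∸ i → Adj (vertex P (i + k)) (vertex P (i + suc k))
      adj′ k k< rewrite +-suc i k = adj P (i + k) (offset-< i k<)
      nb′ : ∀ k → suc (suc k) ≤ L ∸ i → vertex P (i + k) ≢ vertex P (i + suc (suc k))
      nb′ k h rewrite +-suc i (suc k) | +-suc i k =
        nb P (i + k) (subst (_< L) (+-suc i k) (offset-< i h))

  segment : ∀ {u v L} (P : NBWalk u v L) {i j} → i ≤ j → j ≤ L → NBWalk (vertex P i) (vertex P j) (j ∸ i)
  segment P {i} {j} i≤j j≤L = drop (take P j j≤L) i i≤j

  reverse : ∀ {u v L} → NBWalk u v L → NBWalk v u L
  reverse {u} {v} {L} P = record
    { vertex = λ i → vertex P (L ∸ i) ; start = end P ; end = end′ ; adj = adj′ ; nb = nb′ }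
    where
      ∸-suc : ∀ {i L} → i < L → L ∸ i ≡ suc (L ∸ suc i)
      ∸-suc {zero} {suc L} _ = refl
      ∸-suc {suc i} {suc L} (s≤s i<L) = ∸-suc i<L
      ∸-suc-< : ∀ {i} → i < L → L ∸ suc i < L
      ∸-suc-< {i} i<L = ∸-monoʳ-< {L} {suc i} {0} z<s i<L
      end′ : vertex P (L ∸ L) ≡ u
      end′ = trans (cong (vertex P) (n∸n≡0 L)) (start P)
      adj′ : ∀ i → i < L → Adj (vertex P (L ∸ i)) (vertex P (L ∸ suc i))
      adj′ i i<L rewrite ∸-suc i<L = symm (adj P (L ∸ suc i) (∸-suc-< i<L))
      nb′ : ∀ i → suc (suc i) ≤ L → vertex P (L ∸ i) ≢ vertex P (L ∸ suc (suc i))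
      nb′ i h rewrite ∸-suc (<⇒≤ h) | ∸-suc h =
        λ e → nb P (L ∸ suc (suc i)) (subst (_≤ L) (cong suc (∸-suc h)) (∸-suc-< (<⇒≤ h))) (sym e)

  NoReturnAt : ∀ {u v w L K} → NBWalk u v L → NBWalk v w K → Set
  NoReturnAt {L = L} {K} P R = ∀ {L′} → L ≡ suc L′ → 1 ≤ K → vertex P L′ ≢ vertex R 1

  mutual
    append : ∀ {u v w L K} (P : NBWalk u v L) (R : NBWalk v w K) → NoReturnAt P R → NBWalk u w (L + K)
    append {L = zero} P R _ = restart (trans (sym (end P)) (start P)) R
    append {L = suc L} P R join =
      cons (first-edge P) (append {L = L} (drop P 1 (s≤s z≤n)) R (join ∘ cong suc))
           (no-return-after-first {L = L} P R join)

    no-return-after-first : ∀ {u v w L K} (P : NBWalk u v (suc L)) (R : NBWalk v w K) (join : NoReturnAt P R)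
                          → 1 ≤ L + K → u ≢ vertex (append {L = L} (drop P 1 (s≤s z≤n)) R (join ∘ cong suc)) 1
    no-return-after-first {L = zero} P R join 1≤K e = join refl 1≤K (trans (start P) e)
    no-return-after-first {L = suc L} P R join _ e =
      nb P 0 (s≤s (s≤s z≤n)) (trans (start P) (trans e (start (append {L = L} (drop (drop P 1 (s≤s z≤n)) 1 (s≤s z≤n)) R _))))

  fromWalk : ∀ {u v k} → Walk G u v k → Σ ℕ λ L → L ≤ k × NBWalk u v L
  fromWalk here = 0 , z≤n , trivial
  fromWalk {u} (step uw W) with fromWalk W
  ... | zero , _ , Q = 1 , s≤s z≤n , cons uw Q (λ ())
  ... | suc L , L<k , Q with vertex Q 1 ≟ u
  ... | yes returns = L , ≤-trans (n≤1+n L) (m<n⇒m<1+n L<k) , restart returns (drop Q 1 (s≤s z≤n))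
  ... | no ¬returns = suc (suc L) , s≤s L<k , cons uw Q (λ _ e → ¬returns (sym e))

module AcyclicWalks {n : ℕ} (G : Graph n) (acyclic : Acyclic G) where
  open Graph G
  open NonBacktracking G

  cycle-of : ∀ {u m} (P : NBWalk u u (3 + m))
           → Injective _≡_ _≡_ (λ (i : Fin (3 + m)) → vertex P (toℕ i)) → Cycle G m
  cycle-of {m = m} P distinct = record
    { vert = λ i → vertex P (toℕ i) ; inj = distinct ; edges = edges ; close = close }
    where
      edges : ∀ (i : Fin (2 + m)) → Adj (vertex P (toℕ (inject₁ i))) (vertex P (toℕ (Fin.suc i)))
      edges i rewrite toℕ-inject₁ i = adj P (toℕ i) (m<n⇒m<1+n (toℕ<n i))
      close : Adj (vertex P (toℕ (fromℕ (2 + m)))) (vertex P 0)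
      close rewrite toℕ-fromℕ (2 + m) = subst (Adj _) (trans (end P) (sym (start P))) (adj P (2 + m) ≤-refl)

  -- By well-founded induction on the length: a closed walk of length 1 or 2 contradicts
  -- irreflexivity or non-backtracking; a longer one is a cycle unless some vertex repeats,
  -- and a repetition cuts out a shorter closed walk.
  no-closed-nbwalk′ : ∀ {u} L → Acc _<_ L → NBWalk u u L → 0 < L → ⊥
  no-closed-nbwalk′ 1 _ P _ = irrefl (subst (λ x → Adj x (vertex P 1)) (trans (start P) (sym (end P))) (adj P 0 z<s))
  no-closed-nbwalk′ 2 _ P _ = nb P 0 ≤-refl (trans (start P) (sym (end P)))
  no-closed-nbwalk′ (suc (suc (suc m))) (acc shorter) P _
    with injective-or-repeat _≟_ (λ (i : Fin (3 + m)) → vertex P (toℕ i))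
  ... | inj₁ distinct = acyclic m (cycle-of P distinct)
  ... | inj₂ (i , j , i<j , repeat) =
    no-closed-nbwalk′ (toℕ j ∸ toℕ i) (shorter (≤-<-trans (m∸n≤m (toℕ j) (toℕ i)) (toℕ<n j)))
      (retarget (segment P (<⇒≤ i<j) (<⇒≤ (toℕ<n j))) (sym repeat)) (m<n⇒0<n∸m i<j)

  no-closed-nbwalk : ∀ {u L} → NBWalk u u L → 0 < L → ⊥
  no-closed-nbwalk {L = L} = no-closed-nbwalk′ L (<-wellFounded L)

  -- Two non-backtracking u–v walks ending with the same vertex shorten to walks to it;
  -- otherwise the first followed by the reverse of the second is closed and non-backtracking.
  nbwalk-length-unique : ∀ {u v} L M → NBWalk u v L → NBWalk u v M → L ≡ M
  nbwalk-length-unique zero zero _ _ = refl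
  nbwalk-length-unique zero (suc M) P Q = ⊥-elim (no-closed-nbwalk (retarget Q (trans (sym (end P)) (start P))) z<s)
  nbwalk-length-unique (suc L) zero P Q = ⊥-elim (no-closed-nbwalk (retarget P (trans (sym (end Q)) (start Q))) z<s)
  nbwalk-length-unique (suc L) (suc M) P Q with vertex P L ≟ vertex Q M
  ... | yes same = cong suc (nbwalk-length-unique L M (take P L (n≤1+n L)) (retarget (take Q M (n≤1+n M)) (sym same)))
  ... | no different = ⊥-elim (no-closed-nbwalk (append P (reverse Q) λ { refl _ → different }) z<s)

module DiameterThree {n : ℕ} (T : Graph n) (acyclic : Acyclic T) (diam : DiamAtMost T 3) (3≤n : 3 ≤ n) where
  open Graph T
  open Neighbourhood T
  open NonBacktracking T
  open AcyclicWalks T acyclic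

  -- Some walk of length ≤ 3 joins the ends, so by length-uniqueness none is longer.
  nbwalk-length≤3 : ∀ {u v L} → NBWalk u v L → L ≤ 3
  nbwalk-length≤3 {u} {v} {L} P with diam u v
  ... | k , k≤3 , W with fromWalk W
  ... | L′ , L′≤k , Q = subst (_≤ 3) (sym (nbwalk-length-unique L L′ P Q)) (≤-trans L′≤k k≤3)

  no-nbwalk-of-length-4 : ∀ {x₀ x₁ x₂ x₃ x₄} → Adj x₀ x₁ → Adj x₁ x₂ → Adj x₂ x₃ → Adj x₃ x₄
                        → x₀ ≢ x₂ → x₁ ≢ x₃ → x₂ ≢ x₄ → ⊥
  no-nbwalk-of-length-4 a₀₁ a₁₂ a₂₃ a₃₄ n₀₂ n₁₃ n₂₄ =
    4≰3 (nbwalk-length≤3 (cons a₀₁ (cons a₁₂ (cons a₂₃ (cons a₃₄ trivial (λ ())) (λ _ → n₂₄)) (λ _ → n₁₃)) (λ _ → n₀₂)))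
    where
      4≰3 : ¬ 4 ≤ 3
      4≰3 (s≤s (s≤s (s≤s ())))

  -- Every vertex is joined to some other vertex, so it has a neighbour; hence a vertex
  -- that is not a leaf has degree at least 2.
  has-neighbour : ∀ v → ∃ λ c → Adj v c
  has-neighbour v with third-element 3≤n v v
  ... | z , z≢v , _ with diam v z
  ... | _ , _ , here = ⊥-elim (z≢v refl)
  ... | _ , _ , step vc _ = _ , vc

  non-leaf⇒2≤deg : ∀ {v} → ¬ IsLeaf T v → 2 ≤ deg T v
  non-leaf⇒2≤deg {v} = adjacent-non-leaf⇒2≤deg (proj₂ (has-neighbour v))

  -- Of two neighbours a, b of a vertex v one is a leaf: otherwise a′ a v b b′ is a
  -- non-backtracking walk of length 4.
  leaf-neighbour-of-2≤deg : ∀ {v} → 2 ≤ deg T v → ∃ λ w → Adj v w × IsLeaf T w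
  leaf-neighbour-of-2≤deg {v} 2≤deg with neighbour-avoiding 2≤deg v
  ... | a , va , _ with isLeaf? T a
  ... | yes leaf-a = a , va , leaf-a
  ... | no ¬leaf-a with neighbour-avoiding 2≤deg a
  ... | b , vb , b≢a with isLeaf? T b
  ... | yes leaf-b = b , vb , leaf-b
  ... | no ¬leaf-b with neighbour-avoiding (non-leaf⇒2≤deg ¬leaf-a) v | neighbour-avoiding (non-leaf⇒2≤deg ¬leaf-b) v
  ... | a′ , aa′ , a′≢v | b′ , bb′ , b′≢v =
    ⊥-elim (no-nbwalk-of-length-4 (symm aa′) (symm va) vb bb′ a′≢v (b≢a ∘ sym) (b′≢v ∘ sym))

  leaf-or-support : ∀ v → IsLeaf T v ⊎ IsSupport T v
  leaf-or-support v with isLeaf? T v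
  ... | yes leaf = inj₁ leaf
  ... | no ¬leaf = inj₂ (leaf-neighbour-of-2≤deg (non-leaf⇒2≤deg ¬leaf) , non-leaf⇒2≤deg ¬leaf)

  non-support⇒leaf : ∀ {v} → ¬ IsSupport T v → IsLeaf T v
  non-support⇒leaf {v} ¬support with leaf-or-support v
  ... | inj₁ leaf = leaf
  ... | inj₂ support = ⊥-elim (¬support support)

  -- Two adjacent leaves u, w: a non-backtracking walk from u to a third vertex would
  -- pass through w in its interior.
  no-adjacent-leaves : ∀ {u w} → IsLeaf T u → IsLeaf T w → Adj u w → ⊥
  no-adjacent-leaves {u} {w} leaf-u leaf-w uw with third-element 3≤n u w
  ... | z , z≢u , z≢w with diam u z
  ... | _ , _ , W = escape (proj₂ (proj₂ (fromWalk W)))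
    where
      escape : ∀ {L} → NBWalk u z L → ⊥
      escape {zero} Q = z≢u (trans (sym (end Q)) (start Q))
      escape {suc zero} Q = z≢w (trans (sym (end Q)) (leaf-neighbour-unique leaf-u (first-edge Q) uw))
      escape {suc (suc _)} Q = interior-not-leaf Q 0 (s≤s (s≤s z≤n))
        (subst (IsLeaf T) (leaf-neighbour-unique leaf-u uw (first-edge Q)) leaf-w)

  support-neighbour-of-leaf : ∀ {v} → IsLeaf T v → ∃ λ c → Adj v c × IsSupport T c
  support-neighbour-of-leaf leaf-v with leaf-neighbour leaf-v
  ... | c , vc with leaf-or-support c
  ... | inj₁ leaf-c = ⊥-elim (no-adjacent-leaves leaf-v leaf-c vc)
  ... | inj₂ support-c = c , vc , support-c

  -- A support vertex v without support neighbours is adjacent to every non-support vertex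
  -- u: on a non-backtracking v–u walk of length ≥ 2 the second vertex is an interior leaf.
  lonely-support-dominates : ∀ {v} → IsSupport T v → (∀ w → Adj v w → ¬ IsSupport T w)
                           → ∀ u → ¬ IsSupport T u → Adj v u
  lonely-support-dominates {v} support-v lonely u ¬support-u with diam v u
  ... | _ , _ , W with fromWalk W
  ... | zero , _ , Q = ⊥-elim (¬support-u (subst (IsSupport T) (trans (sym (start Q)) (end Q)) support-v))
  ... | suc zero , _ , Q = subst (Adj v) (end Q) (first-edge Q)
  ... | suc (suc _) , _ , Q =
    ⊥-elim (interior-not-leaf Q 0 (s≤s (s≤s z≤n)) (non-support⇒leaf (lonely _ (first-edge Q))))

  non-support-exists : ∃ λ w → ¬ IsSupport T w
  non-support-exists with leaf-or-support (fromℕ< (≤-trans (s≤s z≤n) 3≤n))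
  ... | inj₁ leaf = _ , leaf⇒¬support leaf
  ... | inj₂ ((w , _ , leaf-w) , _) = w , leaf⇒¬support leaf-w

module LowerBound {n : ℕ} (G : Graph n) where
  open Graph G
  open Neighbourhood G
  open Enumeration (isSupport? G)
  open TotalDominatorColoring

  -- A support vertex v forms a colour class on its own: its leaf w is adjacent to all of
  -- some non-empty colour class, which must therefore be {v}.
  support-class-singleton : ∀ {k} (C : TotalDominatorColoring G k) {v} → IsSupport G v
                          → ∀ u → color C u ≡ color C v → u ≡ v
  support-class-singleton C {v} ((w , vw , leaf-w) , _) u same with dominates C w
  ... | j , w-sees-j with onto C j
  ... | x , x-has-j = leaf-neighbour-unique leaf-w (w-sees-j u (trans same v-has-j)) (symm vw)
    where
      x≡v : x ≡ v
      x≡v = leaf-neighbour-unique leaf-w (w-sees-j x (x-has-j refl)) (symm vw)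
      v-has-j : color C v ≡ j
      v-has-j = subst (λ y → color C y ≡ j) x≡v (x-has-j refl)

  lower-bound : ∀ {k} → (∃ λ w → ¬ IsSupport G w) → TotalDominatorColoring G k → suc (numSupport G) ≤ k
  lower-bound {k} (w , ¬support-w) C = injective⇒≤ {f = colour-of} injective
    where
      colour-of : Fin (suc size) → Fin k
      colour-of Fin.zero = color C w
      colour-of (Fin.suc i) = color C (element i)
      w-not-with : ∀ i → color C w ≢ color C (element i)
      w-not-with i same = ¬support-w (subst (IsSupport G) (sym (support-class-singleton C (element-satisfies i) w same))
                                                          (element-satisfies i))
      injective : Injective _≡_ _≡_ colour-of
      injective {Fin.zero} {Fin.zero} _ = refl
      injective {Fin.zero} {Fin.suc j} same = ⊥-elim (w-not-with j same)
      injective {Fin.suc i} {Fin.zero} same = ⊥-elim (w-not-with i (sym same))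
      injective {Fin.suc i} {Fin.suc j} same =
        cong Fin.suc (element-injective (support-class-singleton C (element-satisfies j) (element i) same))

module UpperBound {n : ℕ} (T : Graph n) (acyclic : Acyclic T) (diam : DiamAtMost T 3) (3≤n : 3 ≤ n) where
  open Graph T
  open DiameterThree T acyclic diam 3≤n
  open Enumeration (isSupport? T)

  colour : Fin n → Fin (suc size)
  colour v with isSupport? T v
  ... | yes support-v = Fin.suc (position support-v)
  ... | no _ = Fin.zero

  colour-support : ∀ {v} → IsSupport T v → ∃ λ i → colour v ≡ Fin.suc i × element i ≡ v
  colour-support {v} support-v with isSupport? T v
  ... | yes support-v′ = position support-v′ , refl , element-position support-v′
  ... | no ¬support-v = ⊥-elim (¬support-v support-v)

  colour-non-support : ∀ {v} → ¬ IsSupport T v → colour v ≡ Fin.zero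
  colour-non-support {v} ¬support-v with isSupport? T v
  ... | yes support-v = ⊥-elim (¬support-v support-v)
  ... | no _ = refl

  colour-zero⇒non-support : ∀ {v} → colour v ≡ Fin.zero → ¬ IsSupport T v
  colour-zero⇒non-support coloured-0 support-v with colour-support support-v
  ... | _ , suc-i , _ = 0≢1+n (trans (sym coloured-0) suc-i)

  colour-element : ∀ i → colour (element i) ≡ Fin.suc i
  colour-element i with colour-support (element-satisfies i)
  ... | j , suc-j , same = trans suc-j (cong Fin.suc (element-injective same))

  colour-suc : ∀ {v i} → colour v ≡ Fin.suc i → element i ≡ v
  colour-suc {v} coloured with isSupport? T v
  ... | yes support-v = trans (cong element (sym (suc-injective coloured))) (element-position support-v)
  ... | no _ = ⊥-elim (0≢1+n coloured)

  same-colour-as-support : ∀ {u w} → IsSupport T w → colour u ≡ colour w → u ≡ w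
  same-colour-as-support support-w same with colour-support support-w
  ... | j , suc-j , element-j = trans (sym (colour-suc (trans same suc-j))) element-j

  dominates-via-support : ∀ {v} → (∃ λ w → Adj v w × IsSupport T w) → ∃ λ j → ∀ u → colour u ≡ j → Adj v u
  dominates-via-support {v} (w , vw , support-w) =
    colour w , λ u same → subst (Adj v) (sym (same-colour-as-support support-w same)) vw

  colouring : TotalDominatorColoring T (suc size)
  colouring = record { color = colour ; onto = onto ; proper = proper ; dominates = dominates }
    where
      onto : Surjective _≡_ _≡_ colour
      onto Fin.zero = proj₁ non-support-exists , λ { refl → colour-non-support (proj₂ non-support-exists) }
      onto (Fin.suc i) = element i , λ { refl → colour-element i }

      -- Adjacent vertices of equal colour would be equal, or two adjacent leaves.
      proper : ∀ {u v} → Adj u v → colour u ≢ colour v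
      proper {u} {v} uv same with leaf-or-support u | leaf-or-support v
      ... | inj₂ support-u | _ = irrefl (subst (Adj u) (same-colour-as-support support-u (sym same)) uv)
      ... | inj₁ _ | inj₂ support-v = irrefl (subst (Adj u) (sym (same-colour-as-support support-v same)) uv)
      ... | inj₁ leaf-u | inj₁ leaf-v = no-adjacent-leaves leaf-u leaf-v uv

      -- A leaf or a support vertex with a support neighbour dominates that neighbour's
      -- class; any other support vertex dominates the class 0 of non-support vertices.
      dominates : ∀ v → ∃ λ j → ∀ u → colour u ≡ j → Adj v u
      dominates v with leaf-or-support v
      ... | inj₁ leaf-v = dominates-via-support (support-neighbour-of-leaf leaf-v)
      ... | inj₂ support-v with any? (λ w → adj? v w ×-dec isSupport? T w)
      ... | yes neighbour = dominates-via-support neighbour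
      ... | no lonely = Fin.zero , λ u coloured-0 →
        lonely-support-dominates support-v (λ w vw support-w → lonely (w , vw , support-w)) u
          (colour-zero⇒non-support coloured-0)

proposition6p4 : (n : ℕ) → 3 ≤ n → (T : Graph n) → IsTree T → DiamAtMost T 3
    → TotalDominatorChromaticNumber T (suc (numSupport T))
proposition6p4 n 3≤n T (_ , acyclic) diam = colouring , λ _ → lower-bound non-support-exists
  where
    open DiameterThree T acyclic diam 3≤n using (non-support-exists)
    open UpperBound T acyclic diam 3≤n using (colouring)
    open LowerBound T using (lower-bound)
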